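{- Let $p\neq3$ be a prime and let $u_1,u_2,u_3,c$ be $p$-integral elements of $\mathbb{Q}_p$ such that the cubic $u_1X^3+u_2Y^3+u_3Z^3-cXYZ=0$ is $p$-reduced, $v_p(u_1u_2u_3)>0$, and $0\le v_p(u_1)\le v_p(u_2)\le v_p(u_3)$. The cubic has a nontrivial solution in $\mathbb{Q}_p$ if and only if one of the following holds: (1) $v_p(c)=0$; (2) $v_p(c)>0$, $v_p(u_1)=v_p(u_2)=0$, and the class of $u_1/u_2$ modulo $p$ is a cube in $\mathbb{F}_p^*$; (3) $v_p(c)>0$, $v_p(u_1)=0$, $v_p(u_2)=v_p(u_3)=1$, and the class of $u_2/u_3$ modulo $p$ is a cube in $\mathbb{F}_p^*$.
   Context: The cubic $u_1X^3+u_2Y^3+u_3Z^3-cXYZ=0$ with $p$-integral coefficients is called $p$-reduced if $\min(v_p(u_1),v_p(u_2),v_p(u_3))=0$ and, if $p\mid c$ (in particular if $c=0$), $v_p(u_1u_2u_3)\le2$. -}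

module Defs where

open import Data.Nat using (ℕ; suc; _≤_)
import Data.Nat as ℕ
open import Data.Integer using (ℤ; +_; _+_; _-_; _*_; _^_)
open import Data.Integer.Divisibility using (_∣_)
open import Data.Product using (Σ; _×_)
open import Data.Sum using (_⊎_)
open import Relation.Nullary using (¬_)

-- p-adic integers ℤ_p as the inverse limit of ℤ/p^n ℤ, presented by
-- integer representatives: a sequence (s n) with s n ≡ s m (mod p^m)
-- whenever m ≤ n. Two such sequences represent the same p-adic integer
-- iff they agree modulo p^n at every level n.
record ℤₚ (p : ℕ) : Set where
  constructor mkℤₚ
  field
    seq : ℕ → ℤ
    coh : ∀ {m n} → m ≤ n → (+ (p ℕ.^ m)) ∣ (seq n - seq m)
open ℤₚ public

module _ (p : ℕ) where

  IsZero : (ℕ → ℤ) → Set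
  IsZero s = ∀ n → (+ (p ℕ.^ n)) ∣ s n

  VGe : (ℕ → ℤ) → ℕ → Set
  VGe s k = (+ (p ℕ.^ k)) ∣ s k

  VEq : (ℕ → ℤ) → ℕ → Set
  VEq s k = VGe s k × ¬ VGe s (suc k)

  VLe : (ℕ → ℤ) → (ℕ → ℤ) → Set
  VLe s t = ∀ k → VGe s k → VGe t k

  VPos : (ℕ → ℤ) → Set
  VPos s = VGe s 1

  prod3 : ℤₚ p → ℤₚ p → ℤₚ p → (ℕ → ℤ)
  prod3 a b d n = seq a n * seq b n * seq d n

  cubic : (u1 u2 u3 c X Y Z : ℤₚ p) → (ℕ → ℤ)
  cubic u1 u2 u3 c X Y Z n =
    seq u1 n * seq X n ^ 3 + seq u2 n * seq Y n ^ 3 + seq u3 n * seq Z n ^ 3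
      - seq c n * seq X n * seq Y n * seq Z n

  PReduced : (u1 u2 u3 c : ℤₚ p) → Set
  PReduced u1 u2 u3 c =
    (VEq (seq u1) 0 ⊎ VEq (seq u2) 0 ⊎ VEq (seq u3) 0)
    × (VPos (seq c) → ¬ VGe (prod3 u1 u2 u3) 3)

  -- nontrivial zero over ℚ_p; by homogeneity equivalently over ℤ_p
  HasNontrivialZero : (u1 u2 u3 c : ℤₚ p) → Set
  HasNontrivialZero u1 u2 u3 c =
    Σ (ℤₚ p) λ X → Σ (ℤₚ p) λ Y → Σ (ℤₚ p) λ Z →
      ¬ (IsZero (seq X) × IsZero (seq Y) × IsZero (seq Z))
      × IsZero (cubic u1 u2 u3 c X Y Z)

  UnitRatioCubeModP : (a b : ℤₚ p) → Set
  UnitRatioCubeModP a b =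
    Σ ℤ λ t → ¬ ((+ p) ∣ t) × ((+ p) ∣ (t ^ 3 * seq b 1 - seq a 1))

  -- for a, b of valuation exactly 1: the class of (a/p)/(b/p) mod p is a
  -- cube in F_p^*, i.e. ∃ t, p ∤ t, t^3 (b/p) ≡ a/p (mod p),
  -- equivalently t^3 b ≡ a (mod p^2)
  ValOneRatioCubeModP : (a b : ℤₚ p) → Set
  ValOneRatioCubeModP a b =
    Σ ℤ λ t → ¬ ((+ p) ∣ t) × ((+ (p ℕ.^ 2)) ∣ (t ^ 3 * seq b 2 - seq a 2))

-- If c is a p-adic unit, (1, 1, w) is a zero as soon as u₁ + u₂ − c w + u₃ w³ = 0, and this cubic in w
-- has the simple root (u₁ + u₂)/c modulo p, which Hensel's lemma lifts. If p ∣ c, a zero of the form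
-- modulo p³ either reduces to a binary relation a x³ + b y³ ≡ 0 with a and x units, exhibiting a/b as a
-- cube modulo p (modulo p² after dividing u₂ and u₃ by p), or has all coordinates divisible by p, and
-- then one divides by p and repeats. The cube conditions are decidable by a finite search, so a zero
-- violating them is divisible by every power of p, i.e. trivial. Conversely, a cube root t of the ratio
-- makes −t a root modulo p of u₁ + u₂ w³ (resp. u₂/p + (u₃/p) w³), simple because p ≠ 3, and Hensel's
-- lemma yields the zero (1, W, 0) (resp. (0, 1, W)).

module Submission where

open import Defs
open import Data.Nat using (ℕ)
open import Data.Nat.Primality using (Prime)
open import Data.Product using (_×_)
open import Data.Sum using (_⊎_)
open import Relation.Nullary using (¬_)
open import Relation.Binary.PropositionalEquality using (_≢_)
open import Function.Bundles using (_⇔_)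

open import Data.Nat as ℕ using (zero; suc; _≤_; z≤n; s≤s; NonZero)
import Data.Nat.Properties as ℕP
import Data.Nat.Divisibility as ℕD
import Data.Nat.Coprimality as ℕC
open import Data.Nat.GCD using (module Bézout)
open import Data.Nat.Primality using (prime?; prime⇒nonZero; prime⇒nonTrivial; prime⇒irreducible; euclidsLemma)
open import Data.Integer as ℤ using (ℤ; +_; _+_; _-_; _*_; -_; 0ℤ; 1ℤ; _^_)
import Data.Integer.Properties as ℤP
import Data.Integer.DivMod as ℤDM
import Data.Integer.Divisibility as U
open import Data.Integer.Divisibility.Signed
open import Data.Integer.Tactic.RingSolver using (solve-∀)
open import Data.Product using (Σ; _,_; proj₁; proj₂)
open import Data.Sum as Sum using (inj₁; inj₂; [_,_]′)
open import Data.Fin using (toℕ; fromℕ<)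
import Data.Fin.Properties as FinP
open import Function using (_∘_)
open import Function.Bundles using (mk⇔)
open import Relation.Nullary using (Dec; yes; no; contradiction)
open import Relation.Nullary.Decidable using (map′; _×-dec_; ¬?; from-yes; decidable-stable)
open import Relation.Binary.PropositionalEquality
  using (_≡_; refl; sym; trans; cong; cong₂; subst; subst₂; module ≡-Reasoning)

∣-zero : ∀ {m} → m ∣ 0ℤ
∣-zero = divides 0ℤ refl

∣-diff-refl : ∀ {m} a → m ∣ a - a
∣-diff-refl a = subst (_ ∣_) (sym (ℤP.+-inverseʳ a)) ∣-zero

∣-neg⇒∣ : ∀ {m a} → m ∣ - a → m ∣ a
∣-neg⇒∣ {a = a} h = subst (_ ∣_) (ℤP.neg-involutive a) (∣m⇒∣-m h)

∣-diff⇒∣ˡ : ∀ {m a b} → m ∣ a - b → m ∣ b → m ∣ a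
∣-diff⇒∣ˡ h hb = ∣m+n∣n⇒∣m h (∣m⇒∣-m hb)

∣-diff⇒∣ʳ : ∀ {m a b} → m ∣ a - b → m ∣ a → m ∣ b
∣-diff⇒∣ʳ h ha = ∣-neg⇒∣ (∣m+n∣m⇒∣n h ha)

∣-diff-trans : ∀ {m} a b c → m ∣ a - b → m ∣ b - c → m ∣ a - c
∣-diff-trans a b c h h′ = subst (_ ∣_) (telescope a b c) (∣m∣n⇒∣m+n h h′)
  where
  telescope : ∀ a b c → (a - b) + (b - c) ≡ a - c
  telescope = solve-∀

∣-diff⇒∣cube-diff : ∀ {m} a b → m ∣ a - b → m ∣ a ^ 3 - b ^ 3
∣-diff⇒∣cube-diff a b h = subst (_ ∣_) (identity a b) (∣m⇒∣m*n (a * a + a * b + b * b) h)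
  where
  identity : ∀ a b → (a - b) * (a * a + a * b + b * b) ≡ a * (a * (a * 1ℤ)) - b * (b * (b * 1ℤ))
  identity = solve-∀

∣-* : ∀ {a b x y} → a ∣ x → b ∣ y → a * b ∣ x * y
∣-* {a} {y = y} a∣x b∣y = ∣-trans (*-monoʳ-∣ a b∣y) (*-monoˡ-∣ y a∣x)

depressed : ℤ → ℤ → ℤ → ℤ → ℤ
depressed a b d w = a + b * w + d * w ^ 3

depressed′ : ℤ → ℤ → ℤ → ℤ
depressed′ b d w = b + + 3 * d * (w * w)

depressed-newton : ∀ a b d w e → let f = depressed a b d in
  f (w - f w * e) ≡ f w * (1ℤ - e * depressed′ b d w) + f w * f w * (e * e * (+ 3 * d * w - d * f w * e))
depressed-newton = identity
  where
  identity : ∀ a b d w e →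
    let F = a + b * w + d * (w * (w * (w * 1ℤ)))
        v = w - F * e
    in a + b * v + d * (v * (v * (v * 1ℤ)))
       ≡ F * (1ℤ - e * (b + + 3 * d * (w * w))) + F * F * (e * e * (+ 3 * d * w - d * F * e))
  identity = solve-∀

depressed-cong : ∀ {m} a a′ b b′ d d′ w → m ∣ a - a′ → m ∣ b - b′ → m ∣ d - d′ →
                 m ∣ depressed a b d w - depressed a′ b′ d′ w
depressed-cong a a′ b b′ d d′ w ha hb hd =
  subst (_ ∣_) (identity a a′ b b′ d d′ w)
    (∣m∣n⇒∣m+n (∣m∣n⇒∣m+n ha (∣m⇒∣m*n w hb)) (∣m⇒∣m*n (w ^ 3) hd))
  where
  identity : ∀ a a′ b b′ d d′ w → (a - a′) + (b - b′) * w + (d - d′) * (w * (w * (w * 1ℤ)))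
             ≡ (a + b * w + d * (w * (w * (w * 1ℤ)))) - (a′ + b′ * w + d′ * (w * (w * (w * 1ℤ))))
  identity = solve-∀

depressed′-cong : ∀ {m} b b′ d d′ v w → m ∣ b - b′ → m ∣ d - d′ → m ∣ v - w →
                  m ∣ depressed′ b d v - depressed′ b′ d′ w
depressed′-cong b b′ d d′ v w hb hd hv =
  subst (_ ∣_) (identity b b′ d d′ v w)
    (∣m∣n⇒∣m+n (∣m∣n⇒∣m+n hb (∣m⇒∣m*n (v * v) (∣n⇒∣m*n (+ 3) hd)))
               (∣m⇒∣m*n (v + w) (∣n⇒∣m*n (+ 3 * d′) hv)))
  where
  identity : ∀ b b′ d d′ v w → (b - b′) + + 3 * (d - d′) * (v * v) + + 3 * d′ * (v - w) * (v + w)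
             ≡ (b + + 3 * d * (v * v)) - (b′ + + 3 * d′ * (w * w))
  identity = solve-∀

cubicForm : ℤ → ℤ → ℤ → ℤ → ℤ → ℤ → ℤ → ℤ
cubicForm u₁ u₂ u₃ c x y z = u₁ * x ^ 3 + u₂ * y ^ 3 + u₃ * z ^ 3 - c * x * y * z

cubicForm-scale : ∀ u₁ u₂ u₃ c x y z q →
  cubicForm u₁ u₂ u₃ c (x * q) (y * q) (z * q) ≡ q ^ 3 * cubicForm u₁ u₂ u₃ c x y z
cubicForm-scale = identity
  where
  identity : ∀ u₁ u₂ u₃ c x y z q →
    u₁ * ((x * q) * ((x * q) * ((x * q) * 1ℤ))) + u₂ * ((y * q) * ((y * q) * ((y * q) * 1ℤ)))
      + u₃ * ((z * q) * ((z * q) * ((z * q) * 1ℤ))) - c * (x * q) * (y * q) * (z * q)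
    ≡ q * (q * (q * 1ℤ)) * (u₁ * (x * (x * (x * 1ℤ))) + u₂ * (y * (y * (y * 1ℤ)))
      + u₃ * (z * (z * (z * 1ℤ))) - c * x * y * z)
  identity = solve-∀

module PAdic (p : ℕ) .{{_ : NonZero p}} where

  pℤ : ℤ
  pℤ = + p

  P : ℕ → ℤ
  P k = + (p ℕ.^ k)

  P-suc : ∀ k → P (suc k) ≡ pℤ * P k
  P-suc k = ℤP.pos-* p (p ℕ.^ k)

  P-+ : ∀ m n → P (m ℕ.+ n) ≡ P m * P n
  P-+ m n = trans (cong +_ (ℕP.^-distribˡ-+-* p m n)) (ℤP.pos-* (p ℕ.^ m) (p ℕ.^ n))

  P≡pℤ^ : ∀ k → P k ≡ pℤ ^ k
  P≡pℤ^ zero = refl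
  P≡pℤ^ (suc k) = trans (P-suc k) (cong (pℤ *_) (P≡pℤ^ k))

  P-1 : P 1 ≡ pℤ
  P-1 = trans (P-suc 0) (ℤP.*-identityʳ pℤ)

  P-mono : ∀ {m n} → m ≤ n → P m ∣ P n
  P-mono {m} m≤n with ℕP.m≤n⇒∃[o]m+o≡n m≤n
  ... | o , refl = subst (P m ∣_) (sym (P-+ m o)) (∣m⇒∣m*n (P o) ∣-refl)

  p∣P : ∀ {k} → 1 ≤ k → pℤ ∣ P k
  p∣P {k} 1≤k = subst (_∣ P k) P-1 (P-mono 1≤k)

  P-2 : P 2 ≡ pℤ * pℤ
  P-2 = trans (P≡pℤ^ 2) (cong (pℤ *_) (ℤP.*-identityʳ pℤ))

  P-3 : P 3 ≡ pℤ * pℤ * pℤ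
  P-3 = trans (P≡pℤ^ 3) (identity pℤ)
    where
    identity : ∀ q → q * (q * (q * 1ℤ)) ≡ q * q * q
    identity = solve-∀

  P-suc-∣ : ∀ {k a} → P k ∣ a → P (suc k) ∣ a * pℤ
  P-suc-∣ {k} {a} h = subst (_∣ a * pℤ) (trans (ℤP.*-comm (P k) pℤ) (sym (P-suc k))) (*-monoˡ-∣ pℤ h)

  ∣⇒P³∣cube : ∀ {x} → pℤ ∣ x → P 3 ∣ x ^ 3
  ∣⇒P³∣cube {x} h = subst (_∣ x ^ 3) (sym (P≡pℤ^ 3)) (∣-* h (∣-* h (∣-* h ∣-refl)))

  p∣P₁ : pℤ ∣ P 1
  p∣P₁ = ∣-reflexive (sym P-1)

  VPos⇒∣ : ∀ s → VPos p s → pℤ ∣ s 1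
  VPos⇒∣ s h = subst (_∣ s 1) P-1 (∣ᵤ⇒∣ h)

  ∣⇒VPos : ∀ s → pℤ ∣ s 1 → VPos p s
  ∣⇒VPos s h = ∣⇒∣ᵤ (subst (_∣ s 1) (sym P-1) h)

  VLe-∣ : ∀ s t → VLe p s t → pℤ ∣ s 1 → pℤ ∣ t 1
  VLe-∣ s t s≤t = VPos⇒∣ t ∘ s≤t 1 ∘ ∣⇒VPos s

  VEq0⇒∤ : ∀ s → VEq p s 0 → ¬ pℤ ∣ s 1
  VEq0⇒∤ s (_ , ¬v) = ¬v ∘ ∣⇒VPos s

  ∤⇒VEq0 : ∀ s → ¬ pℤ ∣ s 1 → VEq p s 0
  ∤⇒VEq0 s ∤s = ℕD.1∣ ℤ.∣ s 0 ∣ , ∤s ∘ VPos⇒∣ s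

  ⇒VEq1 : ∀ s → pℤ ∣ s 1 → ¬ P 2 ∣ s 2 → VEq p s 1
  ⇒VEq1 s p∣s P²∤s = ∣⇒VPos s p∣s , P²∤s ∘ ∣ᵤ⇒∣ {P 2} {s 2}

  Coherent : (ℕ → ℤ) → Set
  Coherent s = ∀ n → P n ∣ s (suc n) - s n

  coherent-≤ : ∀ {s} → Coherent s → ∀ {m n} → m ≤ n → P m ∣ s n - s m
  coherent-≤ {s} c {n = zero} z≤n = ∣-diff-refl (s 0)
  coherent-≤ {s} c {m} {suc n} m≤1+n with ℕP.m≤n⇒m<n∨m≡n m≤1+n
  ... | inj₂ refl = ∣-diff-refl (s m)
  ... | inj₁ (s≤s m≤n) =
    ∣-diff-trans (s (suc n)) (s n) (s m) (∣-trans (P-mono m≤n) (c n)) (coherent-≤ {s} c m≤n)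

  fromCoherent : ∀ {s} → Coherent s → ℤₚ p
  fromCoherent {s} c = mkℤₚ s (λ m≤n → ∣⇒∣ᵤ (coherent-≤ {s} c m≤n))

  seq-coh : (x : ℤₚ p) → ∀ {m n} → m ≤ n → P m ∣ seq x n - seq x m
  seq-coh x m≤n = ∣ᵤ⇒∣ (coh x m≤n)

  seq-coherent : (x : ℤₚ p) → Coherent (seq x)
  seq-coherent x n = seq-coh x (ℕP.n≤1+n n)

  seq-∣-lift : (x : ℤₚ p) → ∀ {m k L} → m ∣ P k → k ≤ L → m ∣ seq x k → m ∣ seq x L
  seq-∣-lift x m∣P k≤L = ∣-diff⇒∣ˡ (∣-trans m∣P (seq-coh x k≤L))

  seq-∣-lower : (x : ℤₚ p) → ∀ {m k L} → m ∣ P k → k ≤ L → m ∣ seq x L → m ∣ seq x k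
  seq-∣-lower x m∣P k≤L = ∣-diff⇒∣ʳ (∣-trans m∣P (seq-coh x k≤L))

  coherent-+ : ∀ {s t} → Coherent s → Coherent t → Coherent (λ n → s n + t n)
  coherent-+ {s} {t} cs ct n =
    subst (_ ∣_) (identity (s (suc n)) (s n) (t (suc n)) (t n)) (∣m∣n⇒∣m+n (cs n) (ct n))
    where
    identity : ∀ a b c d → (a - b) + (c - d) ≡ (a + c) - (b + d)
    identity = solve-∀

  coherent-neg : ∀ {s} → Coherent s → Coherent (λ n → - s n)
  coherent-neg {s} cs n = subst (_ ∣_) (identity (s (suc n)) (s n)) (∣m⇒∣-m (cs n))
    where
    identity : ∀ a b → - (a - b) ≡ (- a) - (- b)
    identity = solve-∀

  coherent-const : ∀ z → Coherent (λ _ → z)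
  coherent-const z n = ∣-diff-refl z

  divideByP : ∀ {s} → Coherent s → pℤ ∣ s 1 →
              Σ (ℕ → ℤ) λ s′ → Coherent s′ × (∀ n → s (suc n) ≡ s′ n * pℤ)
  divideByP {s} cs p∣s₁ = s′ , cs′ , s≡s′p
    where
    p∣s : ∀ n → pℤ ∣ s (suc n)
    p∣s n = ∣-diff⇒∣ˡ (∣-trans p∣P₁ (coherent-≤ {s} cs {1} {suc n} (s≤s z≤n))) p∣s₁
    s′ : ℕ → ℤ
    s′ n = quotient (p∣s n)
    s≡s′p : ∀ n → s (suc n) ≡ s′ n * pℤ
    s≡s′p n = _∣_.equality (p∣s n)
    cs′ : Coherent s′
    cs′ n = *-cancelˡ-∣ pℤ (subst₂ _∣_ (P-suc n) eq (cs (suc n)))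
      where
      eq : s (suc (suc n)) - s (suc n) ≡ pℤ * (s′ (suc n) - s′ n)
      eq = trans (cong₂ _-_ (s≡s′p (suc n)) (s≡s′p n)) (identity (s′ (suc n)) (s′ n) pℤ)
        where
        identity : ∀ a b q → a * q - b * q ≡ q * (a - b)
        identity = solve-∀

  module Hensel {a b d : ℕ → ℤ} (ca : Coherent a) (cb : Coherent b) (cd : Coherent d) {w₀ e : ℤ}
                (root₀ : pℤ ∣ depressed (a 1) (b 1) (d 1) w₀)
                (inverse₀ : pℤ ∣ e * depressed′ (b 1) (d 1) w₀ - 1ℤ) where

    f : ℕ → ℤ → ℤ
    f n = depressed (a n) (b n) (d n)

    f′ : ℕ → ℤ → ℤ
    f′ n = depressed′ (b n) (d n)

    f-coh : ∀ {m n} w → m ≤ n → P m ∣ f n w - f m w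
    f-coh {m} {n} w m≤n = depressed-cong (a n) (a m) (b n) (b m) (d n) (d m) w
      (coherent-≤ {a} ca m≤n) (coherent-≤ {b} cb m≤n) (coherent-≤ {d} cd m≤n)

    -- Newton's iteration with the derivative inverted once and for all: e stays an inverse of
    -- f′ modulo p because the iterates never leave the residue class of w₀.
    approx : ℕ → ℤ
    approx zero = w₀
    approx (suc n) = approx n - f (suc (suc n)) (approx n) * e

    Invariant : ℕ → Set
    Invariant n = P (suc n) ∣ f (suc n) (approx n) × pℤ ∣ approx n - w₀

    root-ahead : ∀ {n} → P (suc n) ∣ f (suc n) (approx n) → P (suc n) ∣ f (suc (suc n)) (approx n)
    root-ahead {n} = ∣-diff⇒∣ˡ (f-coh (approx n) (ℕP.n≤1+n (suc n)))

    derivative-inverse : ∀ {n} → pℤ ∣ approx n - w₀ → pℤ ∣ 1ℤ - e * f′ (suc (suc n)) (approx n)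
    derivative-inverse {n} near =
      subst (pℤ ∣_) (identity e (f′ 1 w₀) (f′ (suc (suc n)) (approx n)))
        (∣m∣n⇒∣m+n (∣m⇒∣-m inverse₀) (∣m⇒∣-m (∣n⇒∣m*n e change)))
      where
      level-1 : ∀ {s} → Coherent s → pℤ ∣ s (suc (suc n)) - s 1
      level-1 {s} cs = ∣-trans (p∣P {1} (s≤s z≤n)) (coherent-≤ {s} cs (s≤s z≤n))
      change : pℤ ∣ f′ (suc (suc n)) (approx n) - f′ 1 w₀
      change = depressed′-cong (b (suc (suc n))) (b 1) (d (suc (suc n))) (d 1) (approx n) w₀
                               (level-1 {b} cb) (level-1 {d} cd) near
      identity : ∀ e x y → - (e * x - 1ℤ) + - (e * (y - x)) ≡ 1ℤ - e * y
      identity = solve-∀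

    invariant : ∀ n → Invariant n
    invariant zero = subst (_∣ f 1 w₀) (sym P-1) root₀ , ∣-diff-refl w₀
    invariant (suc n) = root′ , near′
      where
      v = approx n
      F = f (suc (suc n)) v
      F-root : P (suc n) ∣ F
      F-root = root-ahead (proj₁ (invariant n))
      P²∣F² : P (suc (suc n)) ∣ F * F
      P²∣F² = ∣-trans (P-mono (s≤s (ℕP.m≤n+m (suc n) n)))
                      (subst (_∣ F * F) (sym (P-+ (suc n) (suc n))) (∣-* F-root F-root))
      P∣linear : P (suc (suc n)) ∣ F * (1ℤ - e * f′ (suc (suc n)) v)
      P∣linear = subst (_∣ F * (1ℤ - e * f′ (suc (suc n)) v))
                       (trans (ℤP.*-comm (P (suc n)) pℤ) (sym (P-suc (suc n))))
                       (∣-* F-root (derivative-inverse (proj₂ (invariant n))))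
      root′ : P (suc (suc n)) ∣ f (suc (suc n)) (approx (suc n))
      root′ = subst (P (suc (suc n)) ∣_)
                    (sym (depressed-newton (a (suc (suc n))) (b (suc (suc n))) (d (suc (suc n))) v e))
                    (∣m∣n⇒∣m+n P∣linear (∣m⇒∣m*n _ P²∣F²))
      near′ : pℤ ∣ approx (suc n) - w₀
      near′ = subst (pℤ ∣_) (identity v w₀ (F * e))
                (∣m∣n⇒∣m+n (proj₂ (invariant n))
                           (∣m⇒∣-m (∣m⇒∣m*n e (∣-trans (p∣P {suc n} (s≤s z≤n)) F-root))))
        where
        identity : ∀ v w z → (v - w) + - z ≡ (v - z) - w
        identity = solve-∀

    approx-coherent : Coherent approx
    approx-coherent n = subst (P n ∣_) (identity (approx n) (f (suc (suc n)) (approx n) * e))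
      (∣m⇒∣-m (∣m⇒∣m*n e (∣-trans (P-mono (ℕP.n≤1+n n)) (root-ahead (proj₁ (invariant n))))))
      where
      identity : ∀ v z → - z ≡ (v - z) - v
      identity = solve-∀

    approx-root : ∀ n → P n ∣ f n (approx n)
    approx-root n = ∣-diff⇒∣ʳ (f-coh (approx n) (ℕP.n≤1+n n))
                      (∣-trans (P-mono (ℕP.n≤1+n n)) (proj₁ (invariant n)))

  hensel : ∀ {a b d} → Coherent a → Coherent b → Coherent d → ∀ {w₀ e} →
           pℤ ∣ depressed (a 1) (b 1) (d 1) w₀ → pℤ ∣ e * depressed′ (b 1) (d 1) w₀ - 1ℤ →
           Σ (ℤₚ p) λ W → ∀ n → P n ∣ depressed (a n) (b n) (d n) (seq W n)
  hensel {a} {b} {d} ca cb cd {w₀} {e} root₀ inverse₀ =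
    fromCoherent {approx} approx-coherent , approx-root
    where open Hensel {a} {b} {d} ca cb cd {w₀} {e} root₀ inverse₀

  Divides³ : ℤ → ℤ → ℤ → ℤ → Set
  Divides³ m x y z = m ∣ x × m ∣ y × m ∣ z

  DescentStep : Set → ℤ → ℤ → ℤ → ℤ → Set
  DescentStep W u₁ u₂ u₃ c = ∀ {x y z} → P 3 ∣ cubicForm u₁ u₂ u₃ c x y z → W ⊎ Divides³ pℤ x y z

  descent : ∀ {u₁ u₂ u₃ c} {W : Set} → DescentStep W u₁ u₂ u₃ c →
            ∀ k {x y z} → P (k ℕ.* 3) ∣ cubicForm u₁ u₂ u₃ c x y z → W ⊎ Divides³ (P k) x y z
  descent step zero _ = inj₂ (1∣ , 1∣ , 1∣)
    where
    1∣ : ∀ {a} → P 0 ∣ a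
    1∣ {a} = divides a (sym (ℤP.*-identityʳ a))
  descent {u₁} {u₂} {u₃} {c} step (suc k) P∣F with step (∣-trans (P-mono (ℕP.m≤m+n 3 (k ℕ.* 3))) P∣F)
  ... | inj₁ w = inj₁ w
  ... | inj₂ (divides x refl , divides y refl , divides z refl) =
    Sum.map₂ (λ (hx , hy , hz) → P-suc-∣ {k} hx , P-suc-∣ {k} hy , P-suc-∣ {k} hz)
             (descent {u₁} {u₂} {u₃} {c} step k P∣F′)
    where
    P∣F′ : P (k ℕ.* 3) ∣ cubicForm u₁ u₂ u₃ c x y z
    P∣F′ = *-cancelˡ-∣ (P 3) {{ℕP.m^n≢0 p 3}}
      (subst₂ _∣_ (P-+ 3 (k ℕ.* 3))
                  (trans (cubicForm-scale u₁ u₂ u₃ c x y z pℤ) (cong (_* _) (sym (P≡pℤ^ 3))))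
                  P∣F)

  trivial-by-descent : (u₁ u₂ u₃ c X Y Z : ℤₚ p) {W : Set} → ¬ W →
    (∀ {L} → 3 ≤ L → DescentStep W (seq u₁ L) (seq u₂ L) (seq u₃ L) (seq c L)) →
    IsZero p (cubic p u₁ u₂ u₃ c X Y Z) → IsZero p (seq X) × IsZero p (seq Y) × IsZero p (seq Z)
  trivial-by-descent u₁ u₂ u₃ c X Y Z ¬w step isZero =
    (λ n → lower X n (proj₁ (divisible n))) ,
    (λ n → lower Y n (proj₁ (proj₂ (divisible n)))) ,
    (λ n → lower Z n (proj₂ (proj₂ (divisible n))))
    where
    level : ℕ → ℕ
    level n = suc n ℕ.* 3
    divisible : ∀ n → Divides³ (P (suc n)) (seq X (level n)) (seq Y (level n)) (seq Z (level n))
    divisible n = [ (λ w → contradiction w ¬w) , (λ h → h) ]′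
      (descent {seq u₁ (level n)} {seq u₂ (level n)} {seq u₃ (level n)} {seq c (level n)}
               (step (ℕP.m≤m+n 3 (n ℕ.* 3))) (suc n) (∣ᵤ⇒∣ (isZero (level n))))
    lower : (V : ℤₚ p) → ∀ n → P (suc n) ∣ seq V (level n) → P n U.∣ seq V n
    lower V n h = ∣⇒∣ᵤ (seq-∣-lower V ∣-refl (ℕP.≤-trans (ℕP.n≤1+n n) (ℕP.m≤m*n (suc n) 3))
                                      (∣-trans (P-mono (ℕP.n≤1+n n)) h))

module PAdicPrime (p : ℕ) (p-prime : Prime p) where

  instance
    p≢0 : NonZero p
    p≢0 = prime⇒nonZero p-prime

  open PAdic p public

  p≢1 : p ≢ 1
  p≢1 = ℕ.nonTrivial⇒≢1 {{prime⇒nonTrivial p-prime}}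

  p∤1 : ¬ pℤ ∣ 1ℤ
  p∤1 p∣1 = p≢1 (ℕD.∣1⇒≡1 (∣⇒∣ᵤ p∣1))

  p∤3 : p ≢ 3 → ¬ pℤ ∣ + 3
  p∤3 p≢3 p∣3 = [ p≢1 , p≢3 ]′ (prime⇒irreducible (from-yes (prime? 3)) (∣⇒∣ᵤ p∣3))

  euclid : ∀ a b → pℤ ∣ a * b → pℤ ∣ a ⊎ pℤ ∣ b
  euclid a b h = Sum.map ∣ᵤ⇒∣ ∣ᵤ⇒∣
    (euclidsLemma ℤ.∣ a ∣ ℤ.∣ b ∣ p-prime (subst (p ℕD.∣_) (ℤP.abs-* a b) (∣⇒∣ᵤ h)))

  ∤-* : ∀ {a b} → ¬ pℤ ∣ a → ¬ pℤ ∣ b → ¬ pℤ ∣ a * b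
  ∤-* {a} {b} ∤a ∤b h = [ ∤a , ∤b ]′ (euclid a b h)

  ∤-cube : ∀ {a} → ¬ pℤ ∣ a → ¬ pℤ ∣ a ^ 3
  ∤-cube ∤a = ∤-* ∤a (∤-* ∤a (∤-* ∤a p∤1))

  ∣-*cube⇒∣ : ∀ {a} x → ¬ pℤ ∣ a → pℤ ∣ a * x ^ 3 → pℤ ∣ x
  ∣-*cube⇒∣ x ∤a h with pℤ ∣? x
  ... | yes p∣x = p∣x
  ... | no ∤x = contradiction h (∤-* ∤a (∤-cube ∤x))

  ∣-*-unit⇒∣ : ∀ k {a w} → ¬ pℤ ∣ w → P k ∣ a * w → P k ∣ a
  ∣-*-unit⇒∣ zero {a} _ _ = divides a (sym (ℤP.*-identityʳ a))
  ∣-*-unit⇒∣ (suc k) {a} {w} ∤w h with euclid a w (∣-trans (p∣P {suc k} (s≤s z≤n)) h)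
  ... | inj₂ p∣w = contradiction p∣w ∤w
  ... | inj₁ (divides q refl) =
    subst₂ _∣_ (sym (P-suc k)) (ℤP.*-comm pℤ q)
      (*-monoʳ-∣ pℤ (∣-*-unit⇒∣ k ∤w
        (*-cancelˡ-∣ pℤ (subst₂ _∣_ (P-suc k) (identity q pℤ w) h))))
    where
    identity : ∀ q p w → q * p * w ≡ p * (q * w)
    identity = solve-∀

  ∤⇒coprime : ∀ {n} → ¬ pℤ ∣ + n → ℕC.Coprime n p
  ∤⇒coprime ∤n (d∣n , d∣p) with prime⇒irreducible p-prime d∣p
  ... | inj₁ d≡1 = d≡1
  ... | inj₂ refl = contradiction (∣ᵤ⇒∣ d∣n) ∤n

  ∤⇒invertible-ℕ : ∀ {n} → ¬ pℤ ∣ + n → Σ ℤ λ e → pℤ ∣ e * + n - 1ℤ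
  ∤⇒invertible-ℕ {n} ∤n with ℕC.coprime-Bézout (∤⇒coprime ∤n)
  ... | Bézout.+- x y eq = + x , divides (+ y) (begin
    + x * + n - 1ℤ            ≡⟨ cong (_- 1ℤ) (sym (ℤP.pos-* x n)) ⟩
    + (x ℕ.* n) - 1ℤ          ≡⟨ cong (λ k → + k - 1ℤ) (sym eq) ⟩
    + (1 ℕ.+ y ℕ.* p) - 1ℤ    ≡⟨ cong (_- 1ℤ) (ℤP.pos-+ 1 (y ℕ.* p)) ⟩
    1ℤ + + (y ℕ.* p) - 1ℤ     ≡⟨ identity (+ (y ℕ.* p)) ⟩
    + (y ℕ.* p)               ≡⟨ ℤP.pos-* y p ⟩
    + y * pℤ                  ∎)
    where
    open ≡-Reasoning
    identity : ∀ z → 1ℤ + z - 1ℤ ≡ z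
    identity = solve-∀
  ... | Bézout.-+ x y eq = - + x , divides (- + y) (begin
    - + x * + n - 1ℤ          ≡⟨ identity (+ x) (+ n) ⟩
    - (+ x * + n + 1ℤ)        ≡⟨ cong (λ k → - (k + 1ℤ)) (sym (ℤP.pos-* x n)) ⟩
    - (+ (x ℕ.* n) + 1ℤ)      ≡⟨ cong -_ (ℤP.+-comm (+ (x ℕ.* n)) 1ℤ) ⟩
    - + (1 ℕ.+ x ℕ.* n)       ≡⟨ cong (λ k → - + k) eq ⟩
    - + (y ℕ.* p)             ≡⟨ cong -_ (ℤP.pos-* y p) ⟩
    - (+ y * pℤ)              ≡⟨ ℤP.neg-distribˡ-* (+ y) pℤ ⟩
    - + y * pℤ                ∎)
    where
    open ≡-Reasoning
    identity : ∀ x n → - x * n - 1ℤ ≡ - (x * n + 1ℤ)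
    identity = solve-∀

  ∤⇒invertible : ∀ {a} → ¬ pℤ ∣ a → Σ ℤ λ e → pℤ ∣ e * a - 1ℤ
  ∤⇒invertible {a} ∤a with ℤP.+∣i∣≡i⊎+∣i∣≡-i a
  ... | inj₁ eq with ∤⇒invertible-ℕ (∤a ∘ subst (pℤ ∣_) eq)
  ...   | e , h = e , subst (λ k → pℤ ∣ e * k - 1ℤ) eq h
  ∤⇒invertible {a} ∤a | inj₂ eq with ∤⇒invertible-ℕ (∤a ∘ ∣-neg⇒∣ ∘ subst (pℤ ∣_) eq)
  ...   | e , h = - e , subst (pℤ ∣_) (identity e a) (subst (λ k → pℤ ∣ e * k - 1ℤ) eq h)
    where
    identity : ∀ e a → e * - a - 1ℤ ≡ - e * a - 1ℤ
    identity = solve-∀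

  -- UnitRatioCubeModP p u₁ u₂ and ValOneRatioCubeModP p u₂ u₃ are, by definition,
  -- CubeRatio (+ p) (seq u₁ 1) (seq u₂ 1) and CubeRatio (P 2) (seq u₂ 2) (seq u₃ 2).
  RatioCubeRoot : ℤ → ℤ → ℤ → ℤ → Set
  RatioCubeRoot m a b t = ¬ pℤ U.∣ t × m U.∣ t ^ 3 * b - a

  CubeRatio : ℤ → ℤ → ℤ → Set
  CubeRatio m a b = Σ ℤ (RatioCubeRoot m a b)

  ratioCubeRoot-cong : ∀ {m a a′ b b′ t t′} → pℤ ∣ m → m ∣ t - t′ → m ∣ a - a′ → m ∣ b - b′ →
                       RatioCubeRoot m a b t → RatioCubeRoot m a′ b′ t′
  ratioCubeRoot-cong {m} {a} {a′} {b} {b′} {t} {t′} p∣m ht ha hb (∤t , h) =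
    ∤t′ , ∣⇒∣ᵤ (subst (m ∣_) (identity a a′ b b′ t t′)
      (∣m∣n⇒∣m+n (∣m∣n⇒∣m-n (∣m∣n⇒∣m-n (∣ᵤ⇒∣ {m} {t ^ 3 * b - a} h)
                                        (∣m⇒∣m*n b (∣-diff⇒∣cube-diff t t′ ht)))
                             (∣n⇒∣m*n (t′ ^ 3) hb))
                 ha))
    where
    ∤t′ : ¬ pℤ U.∣ t′
    ∤t′ p∣t′ = ∤t (∣⇒∣ᵤ (∣-diff⇒∣ˡ {pℤ} {t} {t′} (∣-trans p∣m ht) (∣ᵤ⇒∣ p∣t′)))
    identity : ∀ a a′ b b′ t t′ →
      (t * (t * (t * 1ℤ)) * b - a) - (t * (t * (t * 1ℤ)) - t′ * (t′ * (t′ * 1ℤ))) * b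
        - t′ * (t′ * (t′ * 1ℤ)) * (b - b′) + (a - a′)
      ≡ t′ * (t′ * (t′ * 1ℤ)) * b′ - a′
    identity = solve-∀

  -- reducing a witness modulo m keeps it a witness, so searching the residues below m decides
  cubeRatio? : ∀ m .{{_ : NonZero m}} → p ℕD.∣ m → ∀ a b → Dec (CubeRatio (+ m) a b)
  cubeRatio? m p∣m a b =
    map′ (λ (i , r) → + toℕ i , r) residue
      (FinP.any? λ i → ¬? (p ℕD.∣? toℕ i) ×-dec (m ℕD.∣? ℤ.∣ (+ toℕ i) ^ 3 * b - a ∣))
    where
    residue : CubeRatio (+ m) a b → Σ _ λ i → RatioCubeRoot (+ m) a b (+ toℕ i)
    residue (t , r) = fromℕ< (ℤDM.n%ℕd<d t m) ,
      subst (λ k → RatioCubeRoot (+ m) a b (+ k)) (sym (FinP.toℕ-fromℕ< (ℤDM.n%ℕd<d t m)))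
        (ratioCubeRoot-cong {+ m} {a} {a} {b} {b} {t} {+ (t ℤ.%ℕ m)}
                            (∣ᵤ⇒∣ p∣m) m∣t-r (∣-diff-refl a) (∣-diff-refl b) r)
      where
      m∣t-r : + m ∣ t - + (t ℤ.%ℕ m)
      m∣t-r = divides (t ℤ./ℕ m)
        (trans (cong (_- + (t ℤ.%ℕ m)) (ℤDM.a≡a%ℕn+[a/ℕn]*n t m)) (identity (+ (t ℤ.%ℕ m)) ((t ℤ./ℕ m) * + m)))
        where
        identity : ∀ r q → r + q - r ≡ q
        identity = solve-∀

  cubeRatio-of-binaryZero : ∀ {a b x y} → ¬ pℤ ∣ a → ¬ pℤ ∣ x → pℤ ∣ a * x ^ 3 + b * y ^ 3 →
                            CubeRatio pℤ a b
  cubeRatio-of-binaryZero {a} {b} {x} {y} ∤a ∤x p∣F = - (y * e) , ∤t , ∣⇒∣ᵤ p∣t³b-a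
    where
    e = proj₁ (∤⇒invertible ∤x)
    ex≡1 : pℤ ∣ e * x - 1ℤ
    ex≡1 = proj₂ (∤⇒invertible ∤x)
    ∤e : ¬ pℤ ∣ e
    ∤e p∣e = p∤1 (∣-diff⇒∣ʳ ex≡1 (∣m⇒∣m*n x p∣e))
    ∤y : ¬ pℤ ∣ y
    ∤y p∣y = ∤-* ∤a (∤-cube ∤x) (∣m+n∣n⇒∣m p∣F (∣n⇒∣m*n b (∣m⇒∣m*n (y * (y * 1ℤ)) p∣y)))
    ∤t : ¬ pℤ U.∣ - (y * e)
    ∤t p∣t = ∤-* ∤y ∤e (∣-neg⇒∣ (∣ᵤ⇒∣ p∣t))
    -- t = -ye is a cube root of a/b because a x³ ≡ -b y³ and e x ≡ 1
    p∣t³b-a : pℤ ∣ (- (y * e)) ^ 3 * b - a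
    p∣t³b-a = subst (pℤ ∣_) (identity a b x y e)
      (∣m∣n⇒∣m+n (∣n⇒∣m*n (- (e * e * e)) p∣F) (∣n⇒∣m*n a (∣-diff⇒∣cube-diff (e * x) 1ℤ ex≡1)))
      where
      identity : ∀ a b x y e →
        - (e * e * e) * (a * (x * (x * (x * 1ℤ))) + b * (y * (y * (y * 1ℤ))))
          + a * ((e * x) * ((e * x) * ((e * x) * 1ℤ)) - 1ℤ)
        ≡ (- (y * e)) * ((- (y * e)) * ((- (y * e)) * 1ℤ)) * b - a
      identity = solve-∀

  private
    t³bp-ap : ∀ t a b → t ^ 3 * (b * pℤ) - a * pℤ ≡ (t ^ 3 * b - a) * pℤ
    t³bp-ap t a b = identity t a b pℤ
      where
      identity : ∀ t a b q → t * (t * (t * 1ℤ)) * (b * q) - a * q ≡ (t * (t * (t * 1ℤ)) * b - a) * q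
      identity = solve-∀

  cubeRatio-*p : ∀ {a b} → CubeRatio pℤ a b → CubeRatio (P 2) (a * pℤ) (b * pℤ)
  cubeRatio-*p {a} {b} (t , ∤t , h) =
    t , ∤t , ∣⇒∣ᵤ (subst₂ _∣_ (sym P-2) (sym (t³bp-ap t a b))
                           (*-monoˡ-∣ pℤ (∣ᵤ⇒∣ {pℤ} {t ^ 3 * b - a} h)))

  cubeRatio-/p : ∀ {a b} → CubeRatio (P 2) (a * pℤ) (b * pℤ) → CubeRatio pℤ a b
  cubeRatio-/p {a} {b} (t , ∤t , h) =
    t , ∤t , ∣⇒∣ᵤ (*-cancelʳ-∣ pℤ {pℤ} {t ^ 3 * b - a}
                     (subst₂ _∣_ P-2 (t³bp-ap t a b) (∣ᵤ⇒∣ {P 2} {t ^ 3 * (b * pℤ) - a * pℤ} h)))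

  cubeRatio-atLevel : ∀ (a b : ℤₚ p) {m k L} → m ∣ P k → pℤ ∣ m → k ≤ L →
                      CubeRatio m (seq a L) (seq b L) → CubeRatio m (seq a k) (seq b k)
  cubeRatio-atLevel a b {m} {k} {L} m∣P p∣m k≤L (t , r) =
    t , ratioCubeRoot-cong {m} {seq a L} {seq a k} {seq b L} {seq b k} {t} {t} p∣m (∣-diff-refl t)
          (∣-trans m∣P (seq-coh a k≤L)) (∣-trans m∣P (seq-coh b k≤L)) r

  descent-step-units : ∀ {u₁ u₂ u₃ c} → ¬ pℤ ∣ u₁ → ¬ pℤ ∣ u₂ → pℤ ∣ u₃ → ¬ P 3 ∣ u₃ → pℤ ∣ c →
                       DescentStep (CubeRatio pℤ u₁ u₂) u₁ u₂ u₃ c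
  descent-step-units {u₁} {u₂} {u₃} {c} ∤u₁ ∤u₂ p∣u₃ P³∤u₃ p∣c {x} {y} {z} P³∣F =
    by-cases (pℤ ∣? x)
    where
    p∣u₁x³+u₂y³ : pℤ ∣ u₁ * x ^ 3 + u₂ * y ^ 3
    p∣u₁x³+u₂y³ = ∣m+n∣n⇒∣m (∣-diff⇒∣ˡ (∣-trans (p∣P {3} (s≤s z≤n)) P³∣F)
                                       (∣m⇒∣m*n z (∣m⇒∣m*n y (∣m⇒∣m*n x p∣c))))
                            (∣m⇒∣m*n (z ^ 3) p∣u₃)
    by-cases : Dec (pℤ ∣ x) → CubeRatio pℤ u₁ u₂ ⊎ Divides³ pℤ x y z
    by-cases (no ∤x) = inj₁ (cubeRatio-of-binaryZero {u₁} {u₂} {x} {y} ∤u₁ ∤x p∣u₁x³+u₂y³)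
    by-cases (yes p∣x) = inj₂ (p∣x , p∣y , p∣z)
      where
      p∣y : pℤ ∣ y
      p∣y = ∣-*cube⇒∣ y ∤u₂ (∣m+n∣m⇒∣n p∣u₁x³+u₂y³ (∣n⇒∣m*n u₁ (∣m⇒∣m*n (x * (x * 1ℤ)) p∣x)))
      P³∣u₃z³ : P 3 ∣ u₃ * z ^ 3
      P³∣u₃z³ = ∣m+n∣m⇒∣n
        (∣-diff⇒∣ˡ P³∣F (∣m⇒∣m*n z (subst (_∣ c * x * y) (sym P-3) (∣-* (∣-* p∣c p∣x) p∣y))))
        (∣m∣n⇒∣m+n (∣n⇒∣m*n u₁ (∣⇒P³∣cube p∣x)) (∣n⇒∣m*n u₂ (∣⇒P³∣cube p∣y)))
      p∣z : pℤ ∣ z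
      p∣z with pℤ ∣? z
      ... | yes p∣z = p∣z
      ... | no ∤z = contradiction (∣-*-unit⇒∣ 3 (∤-cube ∤z) P³∣u₃z³) P³∤u₃

  descent-step-valuationOne : ∀ {u₁ u₂ u₃ c} → ¬ pℤ ∣ u₁ → pℤ ∣ u₂ → ¬ P 2 ∣ u₂ → pℤ ∣ u₃ → ¬ P 2 ∣ u₃ →
                              pℤ ∣ c → DescentStep (CubeRatio (P 2) u₂ u₃) u₁ u₂ u₃ c
  descent-step-valuationOne {u₁} {c = c} ∤u₁ (divides A refl) P²∤u₂ (divides B refl) P²∤u₃ p∣c
                            {x} {y} {z} P³∣F = by-cases (pℤ ∣? y)
    where
    ∤A : ¬ pℤ ∣ A
    ∤A p∣A = P²∤u₂ (subst (_∣ A * pℤ) (sym P-2) (∣-* p∣A ∣-refl))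
    ∤B : ¬ pℤ ∣ B
    ∤B p∣B = P²∤u₃ (subst (_∣ B * pℤ) (sym P-2) (∣-* p∣B ∣-refl))
    p∣x : pℤ ∣ x
    p∣x = ∣-*cube⇒∣ x ∤u₁
      (∣m+n∣n⇒∣m (∣m+n∣n⇒∣m (∣-diff⇒∣ˡ (∣-trans (p∣P {3} (s≤s z≤n)) P³∣F)
                                        (∣m⇒∣m*n z (∣m⇒∣m*n y (∣m⇒∣m*n x p∣c))))
                            (∣m⇒∣m*n (z ^ 3) (∣n⇒∣m*n B ∣-refl)))
                 (∣m⇒∣m*n (y ^ 3) (∣n⇒∣m*n A ∣-refl)))
    P²∣u₂y³+u₃z³ : P 2 ∣ A * pℤ * y ^ 3 + B * pℤ * z ^ 3
    P²∣u₂y³+u₃z³ =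
      ∣m+n∣m⇒∣n (subst (P 2 ∣_) (ℤP.+-assoc (u₁ * x ^ 3) _ _)
                  (∣-diff⇒∣ˡ (∣-trans (P-mono (ℕP.n≤1+n 2)) P³∣F)
                             (subst (_∣ c * x * y * z) (sym P-2) (∣m⇒∣m*n z (∣m⇒∣m*n y (∣-* p∣c p∣x))))))
                (subst (_∣ u₁ * x ^ 3) (sym P-2) (∣n⇒∣m*n u₁ (∣-* p∣x (∣m⇒∣m*n (x * 1ℤ) p∣x))))
    p∣Ay³+Bz³ : pℤ ∣ A * y ^ 3 + B * z ^ 3
    p∣Ay³+Bz³ = *-cancelˡ-∣ pℤ (subst₂ _∣_ P-2 (identity A B y z pℤ) P²∣u₂y³+u₃z³)
      where
      identity : ∀ A B y z q → A * q * (y * (y * (y * 1ℤ))) + B * q * (z * (z * (z * 1ℤ)))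
                               ≡ q * (A * (y * (y * (y * 1ℤ))) + B * (z * (z * (z * 1ℤ))))
      identity = solve-∀
    by-cases : Dec (pℤ ∣ y) → CubeRatio (P 2) (A * pℤ) (B * pℤ) ⊎ Divides³ pℤ x y z
    by-cases (no ∤y) = inj₁ (cubeRatio-*p (cubeRatio-of-binaryZero {A} {B} {y} {z} ∤A ∤y p∣Ay³+Bz³))
    by-cases (yes p∣y) =
      inj₂ (p∣x , p∣y , ∣-*cube⇒∣ z ∤B (∣m+n∣m⇒∣n p∣Ay³+Bz³ (∣n⇒∣m*n A (∣m⇒∣m*n (y * (y * 1ℤ)) p∣y))))

  witness-by-descent : (u₁ u₂ u₃ c : ℤₚ p) {W : Set} → Dec W →
    (∀ {L} → 3 ≤ L → DescentStep W (seq u₁ L) (seq u₂ L) (seq u₃ L) (seq c L)) →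
    HasNontrivialZero p u₁ u₂ u₃ c → W
  witness-by-descent u₁ u₂ u₃ c W? step (X , Y , Z , nontrivial , isZero) =
    decidable-stable W? (λ ¬w → nontrivial (trivial-by-descent u₁ u₂ u₃ c X Y Z ¬w step isZero))

  const : ℤ → ℤₚ p
  const z = fromCoherent {λ _ → z} (coherent-const z)

  const-1≢0 : ¬ IsZero p (seq (const 1ℤ))
  const-1≢0 isZero = p∤1 (subst (_∣ 1ℤ) P-1 (∣ᵤ⇒∣ (isZero 1)))

  nontrivialZero-of-unit-c : (u₁ u₂ u₃ c : ℤₚ p) → pℤ ∣ seq u₃ 1 → ¬ pℤ ∣ seq c 1 →
                             HasNontrivialZero p u₁ u₂ u₃ c
  nontrivialZero-of-unit-c u₁ u₂ u₃ c p∣u₃ ∤c =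
    const 1ℤ , const 1ℤ , W , (λ (X≡0 , _) → const-1≢0 X≡0) , isZero
    where
    a b : ℕ → ℤ
    a n = seq u₁ n + seq u₂ n
    b n = - seq c n
    e = proj₁ (∤⇒invertible ∤c)
    ec≡1 : pℤ ∣ e * seq c 1 - 1ℤ
    ec≡1 = proj₂ (∤⇒invertible ∤c)
    w₀ = a 1 * e
    root₀ : pℤ ∣ depressed (a 1) (b 1) (seq u₃ 1) w₀
    root₀ = subst (pℤ ∣_) (identity (a 1) (seq c 1) e (seq u₃ 1))
              (∣m∣n⇒∣m+n (∣n⇒∣m*n (a 1) (∣m⇒∣-m ec≡1)) (∣m⇒∣m*n (w₀ ^ 3) p∣u₃))
      where
      identity : ∀ a c e u → a * - (e * c - 1ℤ) + u * ((a * e) * ((a * e) * ((a * e) * 1ℤ)))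
                             ≡ a + - c * (a * e) + u * ((a * e) * ((a * e) * ((a * e) * 1ℤ)))
      identity = solve-∀
    inverse₀ : pℤ ∣ - e * depressed′ (b 1) (seq u₃ 1) w₀ - 1ℤ
    inverse₀ = subst (pℤ ∣_) (identity e (seq c 1) (seq u₃ 1) w₀)
                 (∣m∣n⇒∣m+n ec≡1 (∣m⇒∣m*n (- (+ 3 * e * (w₀ * w₀))) p∣u₃))
      where
      identity : ∀ e c u w → (e * c - 1ℤ) + u * - (+ 3 * e * (w * w)) ≡ - e * (- c + + 3 * u * (w * w)) - 1ℤ
      identity = solve-∀
    solution = hensel {a} {b} {seq u₃} (coherent-+ {seq u₁} {seq u₂} (seq-coherent u₁) (seq-coherent u₂))
                 (coherent-neg {seq c} (seq-coherent c)) (seq-coherent u₃) {w₀} {e = - e} root₀ inverse₀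
    W = proj₁ solution
    isZero : IsZero p (cubic p u₁ u₂ u₃ c (const 1ℤ) (const 1ℤ) W)
    isZero n = ∣⇒∣ᵤ (subst (P n ∣_) (identity (seq u₁ n) (seq u₂ n) (seq u₃ n) (seq c n) (seq W n))
                                    (proj₂ solution n))
      where
      identity : ∀ u₁ u₂ u₃ c w → (u₁ + u₂) + - c * w + u₃ * (w * (w * (w * 1ℤ)))
                 ≡ u₁ * (1ℤ * (1ℤ * (1ℤ * 1ℤ))) + u₂ * (1ℤ * (1ℤ * (1ℤ * 1ℤ))) + u₃ * (w * (w * (w * 1ℤ)))
                   - c * 1ℤ * 1ℤ * w
      identity = solve-∀

  cube-root : p ≢ 3 → ∀ {a b} → Coherent a → Coherent b → ¬ pℤ ∣ b 1 → CubeRatio pℤ (a 1) (b 1) →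
              Σ (ℤₚ p) λ W → ∀ n → P n ∣ depressed (a n) 0ℤ (b n) (seq W n)
  cube-root p≢3 {a} {b} ca cb ∤b (t , ∤t , t³b≡a) =
    hensel {a} {λ _ → 0ℤ} {b} ca (coherent-const 0ℤ) cb {w₀ = - t} {e = proj₁ inverse}
           root₀ (proj₂ inverse)
    where
    root₀ : pℤ ∣ depressed (a 1) 0ℤ (b 1) (- t)
    root₀ = subst (pℤ ∣_) (identity (a 1) (b 1) t)
                  (∣m⇒∣-m (∣ᵤ⇒∣ {pℤ} {t ^ 3 * b 1 - a 1} t³b≡a))
      where
      identity : ∀ a b t → - (t * (t * (t * 1ℤ)) * b - a) ≡ a + 0ℤ * - t + b * (- t * (- t * (- t * 1ℤ)))
      identity = solve-∀
    ∤-t : ¬ pℤ ∣ - t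
    ∤-t = ∤t ∘ ∣⇒∣ᵤ ∘ ∣-neg⇒∣
    ∤derivative : ¬ pℤ ∣ depressed′ 0ℤ (b 1) (- t)
    ∤derivative = ∤-* (∤-* (p∤3 p≢3) ∤b) (∤-* ∤-t ∤-t) ∘ subst (pℤ ∣_) (ℤP.+-identityˡ _)
    inverse = ∤⇒invertible ∤derivative

  nontrivialZero-of-unitRatio : p ≢ 3 → (u₁ u₂ u₃ c : ℤₚ p) → ¬ pℤ ∣ seq u₂ 1 →
                                UnitRatioCubeModP p u₁ u₂ → HasNontrivialZero p u₁ u₂ u₃ c
  nontrivialZero-of-unitRatio p≢3 u₁ u₂ u₃ c ∤u₂ ratio =
    const 1ℤ , W , const 0ℤ , (λ (X≡0 , _) → const-1≢0 X≡0) , isZero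
    where
    solution = cube-root p≢3 {seq u₁} {seq u₂} (seq-coherent u₁) (seq-coherent u₂) ∤u₂ ratio
    W = proj₁ solution
    isZero : IsZero p (cubic p u₁ u₂ u₃ c (const 1ℤ) W (const 0ℤ))
    isZero n = ∣⇒∣ᵤ (subst (P n ∣_) (identity (seq u₁ n) (seq u₂ n) (seq u₃ n) (seq c n) (seq W n))
                                    (proj₂ solution n))
      where
      identity : ∀ u₁ u₂ u₃ c w → u₁ + 0ℤ * w + u₂ * (w * (w * (w * 1ℤ)))
                 ≡ u₁ * (1ℤ * (1ℤ * (1ℤ * 1ℤ))) + u₂ * (w * (w * (w * 1ℤ))) + u₃ * (0ℤ * (0ℤ * (0ℤ * 1ℤ)))
                   - c * 1ℤ * w * 0ℤ
      identity = solve-∀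

  nontrivialZero-of-valuationOneRatio : p ≢ 3 → (u₁ u₂ u₃ c : ℤₚ p) → pℤ ∣ seq u₂ 1 → pℤ ∣ seq u₃ 1 →
    ¬ P 2 ∣ seq u₃ 2 → ValOneRatioCubeModP p u₂ u₃ → HasNontrivialZero p u₁ u₂ u₃ c
  nontrivialZero-of-valuationOneRatio p≢3 u₁ u₂ u₃ c p∣u₂ p∣u₃ P²∤u₃ ratio =
    const 0ℤ , const 1ℤ , W , (λ (_ , Y≡0 , _) → const-1≢0 Y≡0) , isZero
    where
    u₂/p = divideByP {seq u₂} (seq-coherent u₂) p∣u₂
    u₃/p = divideByP {seq u₃} (seq-coherent u₃) p∣u₃
    A B : ℕ → ℤ
    A = proj₁ u₂/p
    B = proj₁ u₃/p
    u₂≡Ap : ∀ n → seq u₂ (suc n) ≡ A n * pℤ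
    u₂≡Ap = proj₂ (proj₂ u₂/p)
    u₃≡Bp : ∀ n → seq u₃ (suc n) ≡ B n * pℤ
    u₃≡Bp = proj₂ (proj₂ u₃/p)
    ∤B : ¬ pℤ ∣ B 1
    ∤B p∣B = P²∤u₃ (subst₂ _∣_ (sym P-2) (sym (u₃≡Bp 1)) (∣-* p∣B ∣-refl))
    solution = cube-root p≢3 {A} {B} (proj₁ (proj₂ u₂/p)) (proj₁ (proj₂ u₃/p)) ∤B
                 (cubeRatio-/p (subst₂ (CubeRatio (P 2)) (u₂≡Ap 1) (u₃≡Bp 1) ratio))
    W = proj₁ solution
    root-ahead : ∀ n → P n ∣ depressed (seq u₂ (suc n)) 0ℤ (seq u₃ (suc n)) (seq W n)
    root-ahead n = subst (P n ∣_) (identity (A n) (B n) pℤ (seq W n) (u₂≡Ap n) (u₃≡Bp n))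
                     (∣n⇒∣m*n pℤ (proj₂ solution n))
      where
      identity : ∀ {u v} a b q w → u ≡ a * q → v ≡ b * q →
                 q * depressed a 0ℤ b w ≡ depressed u 0ℤ v w
      identity a b q w refl refl = scale a b q w
        where
        scale : ∀ a b q w → q * (a + 0ℤ * w + b * (w * (w * (w * 1ℤ))))
                            ≡ a * q + 0ℤ * w + b * q * (w * (w * (w * 1ℤ)))
        scale = solve-∀
    isZero : IsZero p (cubic p u₁ u₂ u₃ c (const 0ℤ) (const 1ℤ) W)
    isZero n = ∣⇒∣ᵤ (subst (P n ∣_) (identity (seq u₁ n) (seq u₂ n) (seq u₃ n) (seq c n) (seq W n))
      (∣-diff⇒∣ʳ (depressed-cong (seq u₂ (suc n)) (seq u₂ n) 0ℤ 0ℤ (seq u₃ (suc n)) (seq u₃ n) (seq W n)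
                                 (seq-coherent u₂ n) (∣-diff-refl 0ℤ) (seq-coherent u₃ n))
                 (root-ahead n)))
      where
      identity : ∀ u₁ u₂ u₃ c w → u₂ + 0ℤ * w + u₃ * (w * (w * (w * 1ℤ)))
                 ≡ u₁ * (0ℤ * (0ℤ * (0ℤ * 1ℤ))) + u₂ * (1ℤ * (1ℤ * (1ℤ * 1ℤ))) + u₃ * (w * (w * (w * 1ℤ)))
                   - c * 0ℤ * 1ℤ * w
      identity = solve-∀

module Main {p : ℕ} (p-prime : Prime p) (p≢3 : p ≢ 3) (u₁ u₂ u₃ c : ℤₚ p)
  (reduced : PReduced p u₁ u₂ u₃ c) (positive : VPos p (prod3 p u₁ u₂ u₃))
  (v₁≤v₂ : VLe p (seq u₁) (seq u₂)) (v₂≤v₃ : VLe p (seq u₂) (seq u₃)) where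

  open PAdicPrime p p-prime

  p∣u₁⇒p∣u₂ : pℤ ∣ seq u₁ 1 → pℤ ∣ seq u₂ 1
  p∣u₁⇒p∣u₂ = VLe-∣ (seq u₁) (seq u₂) v₁≤v₂

  p∣u₂⇒p∣u₃ : pℤ ∣ seq u₂ 1 → pℤ ∣ seq u₃ 1
  p∣u₂⇒p∣u₃ = VLe-∣ (seq u₂) (seq u₃) v₂≤v₃

  Conditions : Set
  Conditions =
    VEq p (seq c) 0
    ⊎ (VPos p (seq c) × VEq p (seq u₁) 0 × VEq p (seq u₂) 0 × UnitRatioCubeModP p u₁ u₂)
    ⊎ (VPos p (seq c) × VEq p (seq u₁) 0 × VEq p (seq u₂) 1 × VEq p (seq u₃) 1 × ValOneRatioCubeModP p u₂ u₃)

  p∣u₃ : pℤ ∣ seq u₃ 1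
  p∣u₃ with euclid (seq u₁ 1 * seq u₂ 1) (seq u₃ 1) (VPos⇒∣ (prod3 p u₁ u₂ u₃) positive)
  ... | inj₂ p∣u₃ = p∣u₃
  ... | inj₁ p∣u₁u₂ = [ p∣u₂⇒p∣u₃ ∘ p∣u₁⇒p∣u₂ , p∣u₂⇒p∣u₃ ]′ (euclid (seq u₁ 1) (seq u₂ 1) p∣u₁u₂)

  ∤u₁ : ¬ pℤ ∣ seq u₁ 1
  ∤u₁ with proj₁ reduced
  ... | inj₁ v₁≡0 = VEq0⇒∤ (seq u₁) v₁≡0
  ... | inj₂ (inj₁ v₂≡0) = VEq0⇒∤ (seq u₂) v₂≡0 ∘ p∣u₁⇒p∣u₂
  ... | inj₂ (inj₂ v₃≡0) = VEq0⇒∤ (seq u₃) v₃≡0 ∘ p∣u₂⇒p∣u₃ ∘ p∣u₁⇒p∣u₂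

  P³∤u₁u₂u₃ : pℤ ∣ seq c 1 → ¬ P 3 ∣ seq u₁ 3 * seq u₂ 3 * seq u₃ 3
  P³∤u₁u₂u₃ p∣c = proj₂ reduced (∣⇒VPos (seq c) p∣c) ∘ ∣⇒∣ᵤ

  P¹∣u₃ : P 1 ∣ seq u₃ 3
  P¹∣u₃ = seq-∣-lift u₃ ∣-refl (s≤s z≤n) (subst (_∣ seq u₃ 1) (sym P-1) p∣u₃)

  P²∤u₂ : pℤ ∣ seq c 1 → ¬ P 2 ∣ seq u₂ 2
  P²∤u₂ p∣c P²∣u₂ = P³∤u₁u₂u₃ p∣c (subst (_∣ seq u₁ 3 * seq u₂ 3 * seq u₃ 3) (sym (P-+ 2 1))
    (∣-* (∣n⇒∣m*n (seq u₁ 3) (seq-∣-lift u₂ ∣-refl (ℕP.n≤1+n 2) P²∣u₂)) P¹∣u₃))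

  P²∤u₃ : pℤ ∣ seq c 1 → pℤ ∣ seq u₂ 1 → ¬ P 2 ∣ seq u₃ 2
  P²∤u₃ p∣c p∣u₂ P²∣u₃ = P³∤u₁u₂u₃ p∣c (subst (_∣ seq u₁ 3 * seq u₂ 3 * seq u₃ 3) (sym (P-+ 1 2))
    (∣-* (∣n⇒∣m*n (seq u₁ 3) (seq-∣-lift u₂ ∣-refl (s≤s z≤n) (subst (_∣ seq u₂ 1) (sym P-1) p∣u₂)))
         (seq-∣-lift u₃ ∣-refl (ℕP.n≤1+n 2) P²∣u₃)))

  units-step : pℤ ∣ seq c 1 → ¬ pℤ ∣ seq u₂ 1 → ∀ {L} → 3 ≤ L →
               DescentStep (UnitRatioCubeModP p u₁ u₂) (seq u₁ L) (seq u₂ L) (seq u₃ L) (seq c L)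
  units-step p∣c ∤u₂ {L} 3≤L P³∣F =
    Sum.map₁ (cubeRatio-atLevel u₁ u₂ p∣P₁ ∣-refl 1≤L)
      (descent-step-units (∤u₁ ∘ lower u₁) (∤u₂ ∘ lower u₂) (lift u₃ p∣u₃)
                          (P³∤u₁u₂u₃ p∣c ∘ ∣n⇒∣m*n (seq u₁ 3 * seq u₂ 3) ∘ seq-∣-lower u₃ ∣-refl 3≤L)
                          (lift c p∣c) P³∣F)
    where
    1≤L : 1 ≤ L
    1≤L = ℕP.≤-trans (s≤s z≤n) 3≤L
    lower lift : (x : ℤₚ p) → pℤ ∣ _ → pℤ ∣ _
    lower x = seq-∣-lower x p∣P₁ 1≤L
    lift x = seq-∣-lift x p∣P₁ 1≤L

  valuationOne-step : pℤ ∣ seq c 1 → pℤ ∣ seq u₂ 1 → ∀ {L} → 3 ≤ L →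
                      DescentStep (ValOneRatioCubeModP p u₂ u₃) (seq u₁ L) (seq u₂ L) (seq u₃ L) (seq c L)
  valuationOne-step p∣c p∣u₂ {L} 3≤L P³∣F =
    Sum.map₁ (cubeRatio-atLevel u₂ u₃ ∣-refl (p∣P {2} (s≤s z≤n)) 2≤L)
      (descent-step-valuationOne (∤u₁ ∘ seq-∣-lower u₁ p∣P₁ 1≤L)
        (lift u₂ p∣u₂) (P²∤u₂ p∣c ∘ seq-∣-lower u₂ ∣-refl 2≤L)
        (lift u₃ p∣u₃) (P²∤u₃ p∣c p∣u₂ ∘ seq-∣-lower u₃ ∣-refl 2≤L)
        (lift c p∣c) P³∣F)
    where
    2≤L : 2 ≤ L
    2≤L = ℕP.≤-trans (ℕP.n≤1+n 2) 3≤L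
    1≤L : 1 ≤ L
    1≤L = ℕP.≤-trans (s≤s z≤n) 3≤L
    lift : (x : ℤₚ p) → pℤ ∣ seq x 1 → pℤ ∣ seq x L
    lift x = seq-∣-lift x p∣P₁ 1≤L

  unitRatio : HasNontrivialZero p u₁ u₂ u₃ c → pℤ ∣ seq c 1 → ¬ pℤ ∣ seq u₂ 1 → UnitRatioCubeModP p u₁ u₂
  unitRatio solution p∣c ∤u₂ =
    witness-by-descent u₁ u₂ u₃ c (cubeRatio? p ℕD.∣-refl (seq u₁ 1) (seq u₂ 1)) (units-step p∣c ∤u₂) solution

  valuationOneRatio : HasNontrivialZero p u₁ u₂ u₃ c → pℤ ∣ seq c 1 → pℤ ∣ seq u₂ 1 →
                      ValOneRatioCubeModP p u₂ u₃
  valuationOneRatio solution p∣c p∣u₂ =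
    witness-by-descent u₁ u₂ u₃ c
      (cubeRatio? (p ℕ.^ 2) {{ℕP.m^n≢0 p 2}} (ℕD.m∣m*n (p ℕ.^ 1)) (seq u₂ 2) (seq u₃ 2))
      (valuationOne-step p∣c p∣u₂) solution

  forward : HasNontrivialZero p u₁ u₂ u₃ c → Conditions
  forward solution with pℤ ∣? seq c 1 | pℤ ∣? seq u₂ 1
  ... | no ∤c   | _        = inj₁ (∤⇒VEq0 (seq c) ∤c)
  ... | yes p∣c | no ∤u₂   = inj₂ (inj₁ (∣⇒VPos (seq c) p∣c , ∤⇒VEq0 (seq u₁) ∤u₁ , ∤⇒VEq0 (seq u₂) ∤u₂ ,
                                         unitRatio solution p∣c ∤u₂))
  ... | yes p∣c | yes p∣u₂ = inj₂ (inj₂ (∣⇒VPos (seq c) p∣c , ∤⇒VEq0 (seq u₁) ∤u₁ ,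
                                         ⇒VEq1 (seq u₂) p∣u₂ (P²∤u₂ p∣c) ,
                                         ⇒VEq1 (seq u₃) (p∣u₂⇒p∣u₃ p∣u₂) (P²∤u₃ p∣c p∣u₂) ,
                                         valuationOneRatio solution p∣c p∣u₂))

  backward : Conditions → HasNontrivialZero p u₁ u₂ u₃ c
  backward (inj₁ (_ , ¬v)) = nontrivialZero-of-unit-c u₁ u₂ u₃ c p∣u₃ (¬v ∘ ∣⇒VPos (seq c))
  backward (inj₂ (inj₁ (_ , _ , u₂≡0 , ratio))) =
    nontrivialZero-of-unitRatio p≢3 u₁ u₂ u₃ c (VEq0⇒∤ (seq u₂) u₂≡0) ratio
  backward (inj₂ (inj₂ (_ , _ , (v₂ , _) , (v₃ , ¬v₃) , ratio))) =
    nontrivialZero-of-valuationOneRatio p≢3 u₁ u₂ u₃ c (VPos⇒∣ (seq u₂) v₂) (VPos⇒∣ (seq u₃) v₃)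
                                        (¬v₃ ∘ ∣⇒∣ᵤ) ratio

lemma5p4 : (p : ℕ) → Prime p → p ≢ 3 →
    (u1 u2 u3 c : ℤₚ p) →
    PReduced p u1 u2 u3 c →
    VPos p (prod3 p u1 u2 u3) →
    VLe p (seq u1) (seq u2) → VLe p (seq u2) (seq u3) →
    HasNontrivialZero p u1 u2 u3 c ⇔
      (VEq p (seq c) 0
       ⊎ (VPos p (seq c) × VEq p (seq u1) 0 × VEq p (seq u2) 0 × UnitRatioCubeModP p u1 u2)
       ⊎ (VPos p (seq c) × VEq p (seq u1) 0 × VEq p (seq u2) 1 × VEq p (seq u3) 1
          × ValOneRatioCubeModP p u2 u3))
lemma5p4 p p-prime p≢3 u₁ u₂ u₃ c reduced positive v₁≤v₂ v₂≤v₃ = mk⇔ forward backward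
  where open Main p-prime p≢3 u₁ u₂ u₃ c reduced positive v₁≤v₂ v₂≤v₃
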